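{- Let $k\ge 3$ and let $G$ be an odd $k$-melon graph. Then $G$ is elementary, i.e. $G$ is a connected bipartite graph in which every edge belongs to some perfect matching.
   Context: For $k\ge1$, a $k$-melon graph is the union of $k$ pairwise internally vertex-disjoint paths $P^{(1)},\dots,P^{(k)}$, each of length at least $1$, all having the same two distinct endpoints $s$ and $t$. It is an odd $k$-melon graph if every path $P^{(i)}$ has odd length. A matching of a bipartite graph with bipartition $(A,B)$ is perfect if it has $\min\{|A|,|B|\}$ edges. A bipartite graph is elementary if it is connected and every edge belongs to some perfect matching. -}

module Defs where

open import Data.Nat using (ℕ; suc; _+_; _*_; _≤_; _⊓_)
open import Data.Fin using (Fin; zero; suc; fromℕ; inject₁)
open import Data.Fin.Subset using (Subset; _∈_; _∉_; ∣_∣; ∁)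
open import Data.Product using (Σ; ∃; ∃-syntax; _×_)
open import Data.Sum using (_⊎_)
open import Relation.Binary.PropositionalEquality using (_≡_; _≢_)
open import Relation.Binary.Construct.Closure.ReflexiveTransitive using (Star)
open import Function.Definitions using (Injective)

-- Finite loopless multigraph: vertices Fin n, edges Fin m, each edge
-- has two distinct endpoints src e and tgt e (orientation irrelevant).
record Multigraph : Set where
  field
    n m      : ℕ
    src tgt  : Fin m → Fin n
    loopless : ∀ e → src e ≢ tgt e

module _ (G : Multigraph) where
  open Multigraph G

  Joins : Fin m → Fin n → Fin n → Set
  Joins e u v = (src e ≡ u × tgt e ≡ v) ⊎ (src e ≡ v × tgt e ≡ u)

  record PathIn (s t : Fin n) : Set where
    field
      len     : ℕ
      len≥1   : 1 ≤ len
      vtx     : Fin (suc len) → Fin n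
      edg     : Fin len → Fin m
      vtx-inj : Injective _≡_ _≡_ vtx
      edg-inj : Injective _≡_ _≡_ edg
      start   : vtx zero ≡ s
      end     : vtx (fromℕ len) ≡ t
      joins   : ∀ j → Joins (edg j) (vtx (inject₁ j)) (vtx (suc j))

  Odd : ℕ → Set
  Odd ℓ = ∃[ q ] ℓ ≡ suc (2 * q)

  -- G is a k-melon graph: the union of k pairwise internally
  -- vertex-disjoint s–t paths (distinct paths, hence edge-disjoint).
  record Melon (k : ℕ) : Set where
    field
      s t      : Fin n
      s≢t      : s ≢ t
      path     : Fin k → PathIn s t
      int-disj : ∀ i j a b → i ≢ j →
                 PathIn.vtx (path i) a ≡ PathIn.vtx (path j) b →
                 (PathIn.vtx (path i) a ≡ s) ⊎ (PathIn.vtx (path i) a ≡ t)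
      edg-disj : ∀ i j a b → i ≢ j →
                 PathIn.edg (path i) a ≢ PathIn.edg (path j) b
      cover-v  : ∀ v → ∃[ i ] ∃[ a ] PathIn.vtx (path i) a ≡ v
      cover-e  : ∀ e → ∃[ i ] ∃[ a ] PathIn.edg (path i) a ≡ e

  OddMelon : ℕ → Set
  OddMelon k = Σ (Melon k) λ M → ∀ i → Odd (PathIn.len (Melon.path M i))

  Adj : Fin n → Fin n → Set
  Adj u v = ∃[ e ] Joins e u v

  Connected : Set
  Connected = ∀ u v → Star Adj u v

  IsBipartition : Subset n → Set
  IsBipartition A = ∀ e → (src e ∈ A × tgt e ∉ A) ⊎ (src e ∉ A × tgt e ∈ A)

  IsMatching : Subset m → Set
  IsMatching M = ∀ e e′ → e ∈ M → e′ ∈ M → e ≢ e′ →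
    (src e ≢ src e′) × (src e ≢ tgt e′) × (tgt e ≢ src e′) × (tgt e ≢ tgt e′)

  IsPerfectMatching : Subset n → Subset m → Set
  IsPerfectMatching A M = IsMatching M × ∣ M ∣ ≡ ∣ A ∣ ⊓ ∣ ∁ A ∣

  Elementary : Set
  Elementary = Connected × Σ (Subset n) λ A → IsBipartition A ×
    (∀ e → Σ (Subset m) λ M → IsPerfectMatching A M × e ∈ M)

{-# OPTIONS --safe #-}
module Submission where

-- Colour every vertex by the parity of its position on a path through it.
-- This is well defined because two paths share only s, at position 0, and t,
-- at the odd position len on both; consecutive vertices of a path get
-- different colours, so the colour classes form a bipartition. For a fixed
-- path P, the edges at even positions of P together with the edges at odd
-- positions of every other path form a matching: inner vertices meet at most
-- one edge of their own path, while s and t meet only the first and last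
-- edge of P. It covers the even class (s by P, every other even vertex by
-- its own path), so it is perfect. An edge at an even position of P lies in
-- the matching of P, and one at an odd position lies in the matching of any
-- other path; hence only k ≥ 2 is used.

open import Defs

open import Data.Bool.Base using (if_then_else_)
open import Data.Empty using (⊥-elim)
open import Data.Fin.Base using (Fin; zero; suc; toℕ; fromℕ; fromℕ<; inject₁; lower₁; punchIn)
open import Data.Fin.Induction using (<-weakInduction)
open import Data.Fin.Properties
  using (_≟_; suc-injective; 0≢1+n; toℕ-injective; toℕ-inject₁; toℕ-fromℕ; toℕ-fromℕ<;
         fromℕ≢inject₁; inject₁-injective; inject₁-lower₁; toℕ-lower₁; punchInᵢ≢i)
open import Data.Fin.Subset using (Subset; _∈_; ∣_∣; ∁; _-_; inside; outside)
open import Data.Fin.Subset.Properties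
  using (x∈p∧x≢y⇒x∈p-y; x∈p⇒∣p-x∣<∣p∣; x∈∁p⇒x∉p; x∉p⇒x∈∁p)
open import Data.Nat.Base using (ℕ; zero; suc; _*_; _≤_; z≤n; s≤s; parity)
open import Data.Nat.Properties using (≤-trans; ≤-antisym; ⊓-glb; m⊓n≤m)
open import Data.Parity.Base using (Parity; 0ℙ; 1ℙ; _⁻¹)
open import Data.Parity.Properties using (p≢p⁻¹; ⁻¹-selfInverse; suc-homo-⁻¹; *-homo-*)
  renaming (_≟_ to _≟ℙ_)
open import Data.Product using (Σ; ∃-syntax; _×_; _,_; proj₁; proj₂; uncurry)
open import Data.Sum using (_⊎_; inj₁; inj₂)
import Data.Sum as Sum
open import Data.Vec.Base using (_∷_; []; tabulate; here; there)
open import Data.Vec.Properties using ([]=⇒lookup; lookup⇒[]=; lookup∘tabulate)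
open import Function.Base using (_∘_)
open import Relation.Binary.Construct.Closure.ReflexiveTransitive using (Star; ε; _◅_; _◅◅_; reverse)
open import Relation.Binary.PropositionalEquality
  using (_≡_; _≢_; refl; sym; trans; cong; subst; module ≡-Reasoning)
open import Relation.Nullary using (yes; no; does)
open import Relation.Nullary.Decidable using (dec-true)
open import Relation.Unary using (Pred; Decidable)

subset : ∀ {n ℓ} {P : Pred (Fin n) ℓ} → Decidable P → Subset n
subset P? = tabulate (does ∘ P?)

module _ {n ℓ} {P : Pred (Fin n) ℓ} (P? : Decidable P) {x : Fin n} where

  ∈-subset⁺ : P x → x ∈ subset P?
  ∈-subset⁺ px = lookup⇒[]= x _ (trans (lookup∘tabulate _ x) (dec-true (P? x) px))

  ∈-subset⁻ : x ∈ subset P? → P x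
  ∈-subset⁻ x∈ with P? x | trans (sym (lookup∘tabulate (does ∘ P?) x)) ([]=⇒lookup x∈)
  ... | yes px | _  = px
  ... | no _   | ()

injection⇒∣p∣≤∣q∣ : ∀ {m n} (p : Subset m) (q : Subset n) (f : ∀ x → x ∈ p → Fin n) →
                    (∀ x x∈p → f x x∈p ∈ q) →
                    (∀ {x y} x∈p y∈p → f x x∈p ≡ f y y∈p → x ≡ y) →
                    ∣ p ∣ ≤ ∣ q ∣
injection⇒∣p∣≤∣q∣ []            q f f∈q f-inj = z≤n
injection⇒∣p∣≤∣q∣ (outside ∷ p) q f f∈q f-inj =
  injection⇒∣p∣≤∣q∣ p q (λ x x∈p → f (suc x) (there x∈p)) (λ x x∈p → f∈q (suc x) (there x∈p))
    (λ x∈p y∈p → suc-injective ∘ f-inj (there x∈p) (there y∈p))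
injection⇒∣p∣≤∣q∣ (inside ∷ p) q f f∈q f-inj =
  ≤-trans (s≤s ∣p∣≤∣q-y∣) (x∈p⇒∣p-x∣<∣p∣ (f∈q zero here))
  where
  y : Fin _
  y = f zero here

  ∣p∣≤∣q-y∣ : ∣ p ∣ ≤ ∣ q - y ∣
  ∣p∣≤∣q-y∣ = injection⇒∣p∣≤∣q∣ p (q - y) (λ x x∈p → f (suc x) (there x∈p))
    (λ x x∈p → x∈p∧x≢y⇒x∈p-y (f∈q (suc x) (there x∈p)) (0≢1+n ∘ f-inj here (there x∈p) ∘ sym))
    (λ x∈p y∈p → suc-injective ∘ f-inj (there x∈p) (there y∈p))

parity-suc : ∀ n → parity (suc n) ≡ parity n ⁻¹
parity-suc n = sym (⁻¹-selfInverse (suc-homo-⁻¹ n))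

StepEnd : ∀ {l} → Fin l → Fin (suc l) → Set
StepEnd a x = x ≡ inject₁ a ⊎ x ≡ suc a

stepEnd-zero : ∀ {l} {a : Fin l} → StepEnd a zero → toℕ a ≡ 0
stepEnd-zero {a = a} (inj₁ 0≡a) = trans (sym (toℕ-inject₁ a)) (cong toℕ (sym 0≡a))

stepEnd-fromℕ : ∀ {l} {a : Fin l} → StepEnd a (fromℕ l) → suc (toℕ a) ≡ l
stepEnd-fromℕ (inj₁ l≡a) = ⊥-elim (fromℕ≢inject₁ l≡a)
stepEnd-fromℕ {l} (inj₂ l≡a) = trans (cong toℕ (sym l≡a)) (toℕ-fromℕ l)

stepEnd-parity-injective : ∀ {l} {a b : Fin l} {x} → StepEnd a x → StepEnd b x →
                           parity (toℕ a) ≡ parity (toℕ b) → a ≡ b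
stepEnd-parity-injective (inj₁ p) (inj₁ q) _ = inject₁-injective (trans (sym p) q)
stepEnd-parity-injective (inj₂ p) (inj₂ q) _ = suc-injective (trans (sym p) q)
stepEnd-parity-injective {a = a} (inj₁ p) (inj₂ q) pa≡pb =
  ⊥-elim (adjacent (trans (sym (toℕ-inject₁ a)) (cong toℕ (trans (sym p) q))) pa≡pb)
  where
  adjacent : ∀ {m n} → m ≡ suc n → parity m ≢ parity n
  adjacent {n = n} refl pm≡pn = p≢p⁻¹ _ (trans (sym pm≡pn) (parity-suc n))
stepEnd-parity-injective (inj₂ p) (inj₁ q) pa≡pb =
  sym (stepEnd-parity-injective (inj₁ q) (inj₂ p) (sym pa≡pb))

module _ (G : Multigraph) where
  open Multigraph G

  odd⇒parity≡1ℙ : ∀ {l} → Odd G l → parity l ≡ 1ℙ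
  odd⇒parity≡1ℙ (q , refl) = trans (parity-suc (2 * q)) (cong _⁻¹ (*-homo-* 2 q))

  Incident : Fin m → Fin n → Set
  Incident e v = src e ≡ v ⊎ tgt e ≡ v

  Covers : Subset m → Subset n → Set
  Covers M A = ∀ v → v ∈ A → ∃[ e ] e ∈ M × Incident e v

  Adj-sym : ∀ {u v} → Adj G u v → Adj G v u
  Adj-sym (e , inj₁ (p , q)) = e , inj₂ (p , q)
  Adj-sym (e , inj₂ (p , q)) = e , inj₁ (p , q)

  rooted⇒connected : ∀ {r} → (∀ v → Star (Adj G) r v) → Connected G
  rooted⇒connected walk u v = reverse Adj-sym (walk u) ◅◅ walk v

  incident-unique⇒matching : ∀ {M} →
    (∀ {e e′ v} → e ∈ M → e′ ∈ M → Incident e v → Incident e′ v → e ≡ e′) →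
    IsMatching G M
  incident-unique⇒matching unique e e′ e∈M e′∈M e≢e′ =
    (λ eq → e≢e′ (unique e∈M e′∈M (inj₁ eq) (inj₁ refl))) ,
    (λ eq → e≢e′ (unique e∈M e′∈M (inj₁ eq) (inj₂ refl))) ,
    (λ eq → e≢e′ (unique e∈M e′∈M (inj₂ eq) (inj₁ refl))) ,
    (λ eq → e≢e′ (unique e∈M e′∈M (inj₂ eq) (inj₂ refl)))

  matching⇒incident-unique : ∀ {M e e′ v} → IsMatching G M → e ∈ M → e′ ∈ M →
                             Incident e v → Incident e′ v → e ≡ e′
  matching⇒incident-unique {e = e} {e′} matching e∈M e′∈M ie ie′ with e ≟ e′
  ... | yes e≡e′ = e≡e′
  ... | no e≢e′ with matching e e′ e∈M e′∈M e≢e′ | ie | ie′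
  ...   | ss , _  , _  , _  | inj₁ p | inj₁ q = ⊥-elim (ss (trans p (sym q)))
  ...   | _  , st , _  , _  | inj₁ p | inj₂ q = ⊥-elim (st (trans p (sym q)))
  ...   | _  , _  , ts , _  | inj₂ p | inj₁ q = ⊥-elim (ts (trans p (sym q)))
  ...   | _  , _  , _  , tt | inj₂ p | inj₂ q = ⊥-elim (tt (trans p (sym q)))

  proper-colouring⇒bipartition : (c : Fin n → Parity) → (∀ e → c (src e) ≢ c (tgt e)) →
                                 IsBipartition G (subset (λ v → c v ≟ℙ 0ℙ))
  proper-colouring⇒bipartition c proper = bipartition
    where
    class₀? : Decidable (λ v → c v ≡ 0ℙ)
    class₀? v = c v ≟ℙ 0ℙ

    bipartition : IsBipartition G (subset class₀?)
    bipartition e with c (src e) in cs | c (tgt e) in ct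
    ... | 0ℙ | 1ℙ = inj₁ (∈-subset⁺ class₀? cs , p≢p⁻¹ 1ℙ ∘ trans (sym ct) ∘ ∈-subset⁻ class₀?)
    ... | 1ℙ | 0ℙ = inj₂ (p≢p⁻¹ 1ℙ ∘ trans (sym cs) ∘ ∈-subset⁻ class₀? , ∈-subset⁺ class₀? ct)
    ... | 0ℙ | 0ℙ = ⊥-elim (proper e (trans cs (sym ct)))
    ... | 1ℙ | 1ℙ = ⊥-elim (proper e (trans cs (sym ct)))

  module _ {A : Subset n} (bipartition : IsBipartition G A) where

    end-in : ∀ e → ∃[ v ] Incident e v × v ∈ A
    end-in e with bipartition e
    ... | inj₁ (s∈A , _) = src e , inj₁ refl , s∈A
    ... | inj₂ (_ , t∈A) = tgt e , inj₂ refl , t∈A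

    incident-∈⇒end-in : ∀ {e v} → Incident e v → v ∈ A → proj₁ (end-in e) ≡ v
    incident-∈⇒end-in {e} ie v∈A with bipartition e | ie
    ... | inj₁ _         | inj₁ s≡v = s≡v
    ... | inj₁ (_ , t∉A) | inj₂ refl = ⊥-elim (t∉A v∈A)
    ... | inj₂ (s∉A , _) | inj₁ refl = ⊥-elim (s∉A v∈A)
    ... | inj₂ _         | inj₂ t≡v = t≡v

    matching⇒∣M∣≤∣A∣ : ∀ {M} → IsMatching G M → ∣ M ∣ ≤ ∣ A ∣
    matching⇒∣M∣≤∣A∣ {M} matching = injection⇒∣p∣≤∣q∣ M A (λ e _ → proj₁ (end-in e))
      (λ e _ → proj₂ (proj₂ (end-in e)))
      (λ {e} {e′} e∈M e′∈M eq → matching⇒incident-unique matching e∈M e′∈M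
        (subst (Incident e) eq (proj₁ (proj₂ (end-in e)))) (proj₁ (proj₂ (end-in e′))))

    covering⇒∣A∣≤∣M∣ : ∀ {M} → Covers M A → ∣ A ∣ ≤ ∣ M ∣
    covering⇒∣A∣≤∣M∣ {M} covers = injection⇒∣p∣≤∣q∣ A M (λ v v∈A → proj₁ (covers v v∈A))
      (λ v v∈A → proj₁ (proj₂ (covers v v∈A)))
      (λ {v} {w} v∈A w∈A eq → trans (sym (incident-∈⇒end-in (proj₂ (proj₂ (covers v v∈A))) v∈A))
        (trans (cong (proj₁ ∘ end-in) eq) (incident-∈⇒end-in (proj₂ (proj₂ (covers w w∈A))) w∈A)))

  bipartition-∁ : ∀ {A} → IsBipartition G A → IsBipartition G (∁ A)
  bipartition-∁ bipartition e with bipartition e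
  ... | inj₁ (s∈A , t∉A) = inj₂ ((λ s∈∁A → x∈∁p⇒x∉p s∈∁A s∈A) , x∉p⇒x∈∁p t∉A)
  ... | inj₂ (s∉A , t∈A) = inj₁ (x∉p⇒x∈∁p s∉A , (λ t∈∁A → x∈∁p⇒x∉p t∈∁A t∈A))

  covering-matching⇒perfect : ∀ {A M} → IsBipartition G A → IsMatching G M → Covers M A →
                              IsPerfectMatching G A M
  covering-matching⇒perfect bipartition matching covers = matching ,
    ≤-antisym (⊓-glb (matching⇒∣M∣≤∣A∣ bipartition matching)
                     (matching⇒∣M∣≤∣A∣ (bipartition-∁ bipartition) matching))
              (≤-trans (m⊓n≤m _ _) (covering⇒∣A∣≤∣M∣ bipartition covers))

module _ {G : Multigraph} {s t} (P : PathIn G s t) where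
  open Multigraph G
  open PathIn P

  walk-from-start : ∀ x → Star (Adj G) s (vtx x)
  walk-from-start = <-weakInduction (Star (Adj G) s ∘ vtx)
    (subst (Star (Adj G) s) (sym start) ε) (λ a walk → walk ◅◅ (edg a , joins a) ◅ ε)

  vtx≡start⇒zero : ∀ {x} → vtx x ≡ s → x ≡ zero
  vtx≡start⇒zero x≡s = vtx-inj (trans x≡s (sym start))

  vtx≡end⇒fromℕ : ∀ {x} → vtx x ≡ t → x ≡ fromℕ len
  vtx≡end⇒fromℕ x≡t = vtx-inj (trans x≡t (sym end))

  stepEnd-incident : ∀ {a x} → StepEnd a x → Incident G (edg a) (vtx x)
  stepEnd-incident {a} x-end with joins a
  stepEnd-incident (inj₁ refl) | inj₁ (p , _) = inj₁ p
  stepEnd-incident (inj₂ refl) | inj₁ (_ , q) = inj₂ q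
  stepEnd-incident (inj₁ refl) | inj₂ (_ , q) = inj₂ q
  stepEnd-incident (inj₂ refl) | inj₂ (p , _) = inj₁ p

  incident⇒stepEnd : ∀ {a v} → Incident G (edg a) v → ∃[ x ] StepEnd a x × vtx x ≡ v
  incident⇒stepEnd {a} incident with joins a | incident
  ... | inj₁ (p , _) | inj₁ r = inject₁ a , inj₁ refl , trans (sym p) r
  ... | inj₁ (_ , q) | inj₂ r = suc a , inj₂ refl , trans (sym q) r
  ... | inj₂ (p , _) | inj₁ r = suc a , inj₂ refl , trans (sym p) r
  ... | inj₂ (_ , q) | inj₂ r = inject₁ a , inj₁ refl , trans (sym q) r

  first-step : ∃[ a ] toℕ a ≡ 0 × Incident G (edg a) s
  first-step = a , toℕ-fromℕ< len≥1 , subst (Incident G (edg a)) start (stepEnd-incident (inj₁ 0≡a))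
    where
    a : Fin len
    a = fromℕ< len≥1
    0≡a : zero ≡ inject₁ a
    0≡a = toℕ-injective (sym (trans (toℕ-inject₁ a) (toℕ-fromℕ< len≥1)))

module OddMelonProperties {G : Multigraph} {k} (melon : Melon G k)
                          (odd : ∀ i → Odd G (PathIn.len (Melon.path melon i))) where
  open Multigraph G
  open Melon melon

  len : Fin k → ℕ
  len i = PathIn.len (path i)

  vtx : ∀ i → Fin (suc (len i)) → Fin n
  vtx i = PathIn.vtx (path i)

  edg : ∀ i → Fin (len i) → Fin m
  edg i = PathIn.edg (path i)

  parity-len : ∀ i → parity (len i) ≡ 1ℙ
  parity-len i = odd⇒parity≡1ℙ G (odd i)

  parity-at-s : ∀ i {x} → vtx i x ≡ s → parity (toℕ x) ≡ 0ℙ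
  parity-at-s i x≡s = cong (parity ∘ toℕ) (vtx≡start⇒zero (path i) x≡s)

  parity-at-t : ∀ i {x} → vtx i x ≡ t → parity (toℕ x) ≡ 1ℙ
  parity-at-t i {x} x≡t = begin
    parity (toℕ x)               ≡⟨ cong (parity ∘ toℕ) (vtx≡end⇒fromℕ (path i) x≡t) ⟩
    parity (toℕ (fromℕ (len i))) ≡⟨ cong parity (toℕ-fromℕ (len i)) ⟩
    parity (len i)               ≡⟨ parity-len i ⟩
    1ℙ                           ∎
    where open ≡-Reasoning

  vtx≡⇒parity≡ : ∀ i j {x y} → vtx i x ≡ vtx j y → parity (toℕ x) ≡ parity (toℕ y)
  vtx≡⇒parity≡ i j {x} {y} x≡y with i ≟ j
  ... | yes refl = cong (parity ∘ toℕ) (PathIn.vtx-inj (path i) x≡y)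
  ... | no i≢j with int-disj i j x y i≢j x≡y
  ...   | inj₁ x≡s = trans (parity-at-s i x≡s) (sym (parity-at-s j (trans (sym x≡y) x≡s)))
  ...   | inj₂ x≡t = trans (parity-at-t i x≡t) (sym (parity-at-t j (trans (sym x≡y) x≡t)))

  colour : Fin n → Parity
  colour v = parity (toℕ (proj₁ (proj₂ (cover-v v))))

  colour-vtx : ∀ i x → colour (vtx i x) ≡ parity (toℕ x)
  colour-vtx i x with cover-v (vtx i x)
  ... | j , y , y≡x = vtx≡⇒parity≡ j i y≡x

  colour-step : ∀ j a → colour (vtx j (inject₁ a)) ≢ colour (vtx j (suc a))
  colour-step j a same = p≢p⁻¹ (parity (toℕ a)) (begin
    parity (toℕ a)               ≡⟨ cong parity (toℕ-inject₁ a) ⟨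
    parity (toℕ (inject₁ a))     ≡⟨ colour-vtx j (inject₁ a) ⟨
    colour (vtx j (inject₁ a))   ≡⟨ same ⟩
    colour (vtx j (suc a))       ≡⟨ colour-vtx j (suc a) ⟩
    parity (suc (toℕ a))         ≡⟨ parity-suc (toℕ a) ⟩
    parity (toℕ a) ⁻¹            ∎)
    where open ≡-Reasoning

  colour-proper : ∀ e → colour (src e) ≢ colour (tgt e)
  colour-proper e with cover-e e
  ... | j , a , refl with PathIn.joins (path j) a
  ...   | inj₁ (p , q) rewrite p | q = colour-step j a
  ...   | inj₂ (p , q) rewrite p | q = colour-step j a ∘ sym

  colour₀? : Decidable (λ v → colour v ≡ 0ℙ)
  colour₀? v = colour v ≟ℙ 0ℙ

  A : Subset n
  A = subset colour₀?

  bipartition : IsBipartition G A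
  bipartition = proper-colouring⇒bipartition G colour colour-proper

  connected : Connected G
  connected = rooted⇒connected G walk-from-s
    where
    walk-from-s : ∀ v → Star (Adj G) s v
    walk-from-s v with cover-v v
    ... | i , x , refl = walk-from-start (path i) x

  position : Fin m → Σ (Fin k) (Fin ∘ len)
  position e = proj₁ (cover-e e) , proj₁ (proj₂ (cover-e e))

  position-edg : ∀ j a → position (edg j a) ≡ (j , a)
  position-edg j a with cover-e (edg j a)
  ... | i , b , b≡a with i ≟ j
  ...   | yes refl = cong (i ,_) (PathIn.edg-inj (path i) b≡a)
  ...   | no i≢j   = ⊥-elim (edg-disj i j b a i≢j b≡a)

  terminal-step-even : ∀ j {a x} → StepEnd a x → vtx j x ≡ s ⊎ vtx j x ≡ t →
                       parity (toℕ a) ≡ 0ℙ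
  terminal-step-even j {a} x-end (inj₁ x≡s) =
    cong parity (stepEnd-zero (subst (StepEnd a) (vtx≡start⇒zero (path j) x≡s) x-end))
  terminal-step-even j {a} x-end (inj₂ x≡t) = begin
    parity (toℕ a)            ≡⟨ suc-homo-⁻¹ (toℕ a) ⟨
    parity (suc (toℕ a)) ⁻¹   ≡⟨ cong (λ l → parity l ⁻¹) a-last ⟩
    parity (len j) ⁻¹         ≡⟨ cong _⁻¹ (parity-len j) ⟩
    0ℙ                        ∎
    where
    open ≡-Reasoning
    a-last : suc (toℕ a) ≡ len j
    a-last = stepEnd-fromℕ (subst (StepEnd a) (vtx≡end⇒fromℕ (path j) x≡t) x-end)

  module Matching (i₀ : Fin k) where

    phase : Fin k → Parity
    phase j = if does (j ≟ i₀) then 0ℙ else 1ℙ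

    phase-i₀ : phase i₀ ≡ 0ℙ
    phase-i₀ with i₀ ≟ i₀
    ... | yes _    = refl
    ... | no i₀≢i₀ = ⊥-elim (i₀≢i₀ refl)

    phase-≢ : ∀ {j} → j ≢ i₀ → phase j ≡ 1ℙ
    phase-≢ {j} j≢i₀ with j ≟ i₀
    ... | yes j≡i₀ = ⊥-elim (j≢i₀ j≡i₀)
    ... | no _     = refl

    phase≡0ℙ⇒i₀ : ∀ {j} → phase j ≡ 0ℙ → j ≡ i₀
    phase≡0ℙ⇒i₀ {j} _ with j ≟ i₀
    phase≡0ℙ⇒i₀ _  | yes j≡i₀ = j≡i₀
    phase≡0ℙ⇒i₀ () | no _

    Chosen : Σ (Fin k) (Fin ∘ len) → Set
    Chosen (j , a) = parity (toℕ a) ≡ phase j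

    chosen? : Decidable Chosen
    chosen? (j , a) = parity (toℕ a) ≟ℙ phase j

    M : Subset m
    M = subset (chosen? ∘ position)

    chosen⇒edg∈M : ∀ {j a} → Chosen (j , a) → edg j a ∈ M
    chosen⇒edg∈M {j} {a} chosen =
      ∈-subset⁺ (chosen? ∘ position) (subst Chosen (sym (position-edg j a)) chosen)

    edg∈M⇒chosen : ∀ {j a} → edg j a ∈ M → Chosen (j , a)
    edg∈M⇒chosen {j} {a} e∈M = subst Chosen (position-edg j a) (∈-subset⁻ (chosen? ∘ position) e∈M)

    chosen-unique : ∀ {j j′ a a′ x y} → Chosen (j , a) → Chosen (j′ , a′) →
                    StepEnd a x → StepEnd a′ y → vtx j x ≡ vtx j′ y → (j , a) ≡ (j′ , a′)
    chosen-unique {j} {j′} {a} {a′} {x} {y} chosen chosen′ x-end y-end x≡y with j ≟ j′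
    ... | yes refl = cong (j ,_) (stepEnd-parity-injective x-end y-end′ (trans chosen (sym chosen′)))
      where
      y-end′ : StepEnd a′ x
      y-end′ = subst (StepEnd a′) (sym (PathIn.vtx-inj (path j) x≡y)) y-end
    ... | no j≢j′ = ⊥-elim (j≢j′ (trans j≡i₀ (sym j′≡i₀)))
      where
      terminal : vtx j x ≡ s ⊎ vtx j x ≡ t
      terminal = int-disj j j′ x y j≢j′ x≡y
      j≡i₀ : j ≡ i₀
      j≡i₀ = phase≡0ℙ⇒i₀ (trans (sym chosen) (terminal-step-even j x-end terminal))
      j′≡i₀ : j′ ≡ i₀
      j′≡i₀ = phase≡0ℙ⇒i₀ (trans (sym chosen′)
        (terminal-step-even j′ y-end (Sum.map (trans (sym x≡y)) (trans (sym x≡y)) terminal)))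

    matching : IsMatching G M
    matching = incident-unique⇒matching G unique
      where
      unique : ∀ {e e′ v} → e ∈ M → e′ ∈ M → Incident G e v → Incident G e′ v → e ≡ e′
      unique {e} {e′} e∈M e′∈M ie ie′ with cover-e e | cover-e e′
      ... | j , a , refl | j′ , a′ , refl
        with incident⇒stepEnd (path j) ie | incident⇒stepEnd (path j′) ie′
      ... | x , x-end , x≡v | y , y-end , y≡v = cong (uncurry edg)
        (chosen-unique (edg∈M⇒chosen e∈M) (edg∈M⇒chosen e′∈M) x-end y-end (trans x≡v (sym y≡v)))

    even-covered : ∀ i x → parity (toℕ x) ≡ 0ℙ → ∃[ e ] e ∈ M × Incident G e (vtx i x)
    even-covered i x even with i ≟ i₀
    ... | yes refl =
      edg i a ,
      chosen⇒edg∈M (trans (cong parity (toℕ-lower₁ x len≢x)) (trans even (sym phase-i₀))) ,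
      stepEnd-incident (path i) (inj₁ (sym (inject₁-lower₁ x len≢x)))
      where
      len≢x : len i ≢ toℕ x
      len≢x len≡x = p≢p⁻¹ 0ℙ (trans (sym even) (trans (cong parity (sym len≡x)) (parity-len i)))
      a : Fin (len i)
      a = lower₁ x len≢x
    even-covered i zero _ | no _ with first-step (path i₀)
    ... | a , a≡0 , a∋s =
      edg i₀ a ,
      chosen⇒edg∈M (trans (cong parity a≡0) (sym phase-i₀)) ,
      subst (Incident G (edg i₀ a)) (sym (PathIn.start (path i))) a∋s
    even-covered i (suc b) even | no i≢i₀ =
      edg i b ,
      chosen⇒edg∈M (trans (sym (suc-homo-⁻¹ (toℕ b))) (trans (cong _⁻¹ even) (sym (phase-≢ i≢i₀)))) ,
      stepEnd-incident (path i) (inj₂ refl)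

    covers : Covers G M A
    covers v v∈A with cover-v v
    ... | i , x , refl = even-covered i x (trans (sym (colour-vtx i x)) (∈-subset⁻ colour₀? v∈A))

    perfect : IsPerfectMatching G A M
    perfect = covering-matching⇒perfect G bipartition matching covers

  every-edge-in-perfect-matching : (∀ j → ∃[ i ] i ≢ j) →
                                   ∀ e → Σ (Subset m) λ N → IsPerfectMatching G A N × e ∈ N
  every-edge-in-perfect-matching another e with cover-e e
  ... | j , a , refl with parity (toℕ a) in pa
  ... | 0ℙ = M , perfect , chosen⇒edg∈M (trans pa (sym phase-i₀))
    where open Matching j
  ... | 1ℙ with another j
  ...   | i , i≢j = M , perfect , chosen⇒edg∈M (trans pa (sym (phase-≢ (i≢j ∘ sym))))
    where open Matching i

lemma8 : (k : ℕ) → 3 ≤ k → (G : Multigraph) → OddMelon G k → Elementary G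
lemma8 _ (s≤s (s≤s (s≤s _))) G (melon , odd) =
  connected , A , bipartition , every-edge-in-perfect-matching another
  where
  open OddMelonProperties melon odd

  another : ∀ j → ∃[ i ] i ≢ j
  another j = punchIn j zero , punchInᵢ≢i j zero
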